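{- Let $S$ be a partial Sudoku of type $(h,w)$. Then (a) $K[S]\mathbf{1}=\mathbf{0}$, and (b) $K[S]M_S=O$. In other words, the range of $K[S]$ is orthogonal to the all-ones vector and to the range of $M_S$.
   Context: Let $h,w\ge 2$, $n=hw$, $\mathrm{box}(i,j)=h\lfloor (i-1)/h\rfloor+\lfloor (j-1)/w\rfloor+1$. A partial Sudoku of type $(h,w)$ is an $n\times n$ array with cells empty or filled from $[n]$, each symbol at most once in each row, column and box $\mathrm{box}^{ -1}(\ell)$. $G_{hw}$ has vertices $r_i,c_j,b_\ell,s_k$ ($i,j,k,\ell\in[n]$) and edges $\{r_i,c_j\},\{r_i,s_k\},\{c_j,s_k\},\{b_\ell,s_k\}$ for all indices. A tile is the edge set $\{r_ic_j,r_is_k,c_js_k,b_\ell s_k\}$ with $\ell=\mathrm{box}(i,j)$. $W$ is the $4n^2\times n^3$ zero-one edge-versus-tile inclusion matrix of $G_{hw}$ and $M=WW^\top$; $K$ is the $4n^2\times 4n^2$ orthogonal projection matrix onto $\ker(M)$. For $S$, $G_S$ is obtained from $G_{hw}$ by deleting the edges of the tile of $(i,j,k)$ for each filled cell $(i,j)$ with symbol $k$; $T(G_S)$ is the set of tiles all of whose edges lie in $G_S$; $W_S$ is the zero-one inclusion matrix of $E(G_S)$ versus $T(G_S)$ and $M_S=W_SW_S^\top$. $K[S]$ is the principal submatrix of $K$ with rows and columns indexed by $E(G_S)$, and $\mathbf{1}$ is the all-ones vector indexed by $E(G_S)$.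
   Formalization: The projection matrix $K$ onto $\ker(M)$, together with the vectors against which its projection properties are tested, has rational entries. -}

module Defs where

open import Data.Nat using (ℕ; _*_; _+_; _/_; _≤_; NonZero)
import Data.Nat as ℕ
open import Data.Fin using (Fin; toℕ; _≟_)
open import Data.List using (List; []; _∷_; map; concatMap; foldr)
open import Data.Bool using (Bool; true; false; _∧_; _∨_; not; if_then_else_)
open import Data.Maybe using (Maybe; just; nothing)
open import Data.Product using (_×_; _,_)
open import Data.Sum using (_⊎_)
open import Data.Rational using (ℚ; 0ℚ; 1ℚ) renaming (_+_ to _+ℚ_; _*_ to _*ℚ_)
open import Relation.Nullary using (does)
open import Relation.Binary.PropositionalEquality using (_≡_)
open import Data.Vec.Functional using () renaming (Vector to _⇒_)

-- Conventions: all indices are 0-based (Fin n); row i, column j, symbol k.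
-- box (0-based) = h * (i / h) + j / w, the 0-based version of
-- box(i,j) = h⌊(i-1)/h⌋ + ⌊(j-1)/w⌋ + 1.
box : (h w : ℕ) → .{{NonZero h}} → .{{NonZero w}} → ℕ → ℕ → ℕ
box h w i j = h * (i / h) + j / w

-- Edges of G_hw : r_i c_j , r_i s_k , c_j s_k , b_l s_k.
data Edge (n : ℕ) : Set where
  rc : Fin n → Fin n → Edge n
  rs : Fin n → Fin n → Edge n
  cs : Fin n → Fin n → Edge n
  bs : Fin n → Fin n → Edge n

allB : {A : Set} → (A → Bool) → List A → Bool
allB p xs = foldr (λ a acc → p a ∧ acc) true xs

allFin : (n : ℕ) → List (Fin n)
allFin n = Data.List.allFin n

allEdges : (n : ℕ) → List (Edge n)
allEdges n =
  concatMap (λ a → concatMap (λ b → rc a b ∷ rs a b ∷ cs a b ∷ bs a b ∷ []) (allFin n)) (allFin n)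

Tile : ℕ → Set
Tile n = Fin n × Fin n × Fin n

allTiles : (n : ℕ) → List (Tile n)
allTiles n =
  concatMap (λ i → concatMap (λ j → map (λ k → (i , j , k)) (allFin n)) (allFin n)) (allFin n)

_=ᶠ_ : {n : ℕ} → Fin n → Fin n → Bool
a =ᶠ b = does (a ≟ b)

_=ⁿ_ : ℕ → ℕ → Bool
a =ⁿ b = does (a ℕ.≟ b)

inTile : (h w : ℕ) → .{{NonZero h}} → .{{NonZero w}} → Tile (h * w) → Edge (h * w) → Bool
inTile h w (i , j , k) (rc a b) = (a =ᶠ i) ∧ (b =ᶠ j)
inTile h w (i , j , k) (rs a b) = (a =ᶠ i) ∧ (b =ᶠ k)
inTile h w (i , j , k) (cs a b) = (a =ᶠ j) ∧ (b =ᶠ k)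
inTile h w (i , j , k) (bs l b) = (toℕ l =ⁿ box h w (toℕ i) (toℕ j)) ∧ (b =ᶠ k)

Σ[_]_ : {A : Set} → List A → (A → ℚ) → ℚ
Σ[ xs ] f = foldr (λ a acc → f a +ℚ acc) 0ℚ xs

EMat : ℕ → Set
EMat n = Edge n → Edge n → ℚ

W : (h w : ℕ) → .{{NonZero h}} → .{{NonZero w}} → Edge (h * w) → Tile (h * w) → ℚ
W h w e t = if inTile h w t e then 1ℚ else 0ℚ

M : (h w : ℕ) → .{{NonZero h}} → .{{NonZero w}} → EMat (h * w)
M h w e f = Σ[ allTiles (h * w) ] (λ t → W h w e t *ℚ W h w f t)

IsOrthProjOntoKer : {n : ℕ} → EMat n → EMat n → Set
IsOrthProjOntoKer {n} A P =
  (∀ e f → P e f ≡ P f e)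
  × (∀ e f → Σ[ allEdges n ] (λ g → P e g *ℚ P g f) ≡ P e f)
  × (∀ (x : Edge n → ℚ) e →
       Σ[ allEdges n ] (λ f → A e f *ℚ Σ[ allEdges n ] (λ g → P f g *ℚ x g)) ≡ 0ℚ)
  × (∀ (x : Edge n → ℚ) →
       (∀ e → Σ[ allEdges n ] (λ f → A e f *ℚ x f) ≡ 0ℚ) →
       ∀ e → Σ[ allEdges n ] (λ f → P e f *ℚ x f) ≡ x e)

Array : ℕ → Set
Array n = Fin n → Fin n → Maybe (Fin n)

IsPartialSudoku : (h w : ℕ) → .{{NonZero h}} → .{{NonZero w}} → Array (h * w) → Set
IsPartialSudoku h w S =
  ∀ i j i' j' k → S i j ≡ just k → S i' j' ≡ just k →
  (i ≡ i' ⊎ j ≡ j' ⊎ box h w (toℕ i) (toℕ j) ≡ box h w (toℕ i') (toℕ j')) →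
  (i ≡ i' × j ≡ j')

inGS : (h w : ℕ) → .{{NonZero h}} → .{{NonZero w}} → Array (h * w) → Edge (h * w) → Bool
inGS h w S e =
  allB (λ i → allB (λ j → cellOK (S i j) i j) (allFin (h * w))) (allFin (h * w))
  where
  cellOK : Maybe (Fin (h * w)) → Fin (h * w) → Fin (h * w) → Bool
  cellOK nothing i j = true
  cellOK (just k) i j = not (inTile h w (i , j , k) e)

inTGS : (h w : ℕ) → .{{NonZero h}} → .{{NonZero w}} → Array (h * w) → Tile (h * w) → Bool
inTGS h w S t = allB (λ e → not (inTile h w t e) ∨ inGS h w S e) (allEdges (h * w))

-- M_S = W_S W_Sᵀ (indexed by E(G_S); entries only used for edges of G_S).
MS : (h w : ℕ) → .{{NonZero h}} → .{{NonZero w}} → Array (h * w) → EMat (h * w)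
MS h w S e f =
  Σ[ allTiles (h * w) ] (λ t → if inTGS h w S t then W h w e t *ℚ W h w f t else 0ℚ)

-- Rows z of K lie in ker M, and ker (W Wᵀ) = ker Wᵀ because zᵀ W Wᵀ z is a sum of squares; so
-- every tile sum Σ_{f ∈ t} z_f vanishes.  (b) A tile of T(G_S) has all its edges in G_S, so the
-- restricted product Σ_{g ∈ G_S} z_g (M_S)_{gf} regroups as Σ_{t ∈ T(G_S)} W_{ft} Σ_{g ∈ t} z_g = 0.
-- (a) Each edge lies in exactly n tiles, hence n Σ_f z_f = Σ_t Σ_{f ∈ t} z_f = 0.  Since S is a
-- partial Sudoku, the tiles of its filled cells are pairwise edge-disjoint and cover exactly the
-- edges outside G_S, so the sum of z over those edges is again a sum of tile sums, i.e. 0.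
{-# OPTIONS --safe #-}
module Submission where

open import Defs
open import Data.Nat using (ℕ; zero; suc; _*_; _+_; _/_; _<_; _≤_; NonZero)
import Data.Nat.Properties as ℕ
open import Data.Nat.DivMod using (+-distrib-/-∣ˡ; m*n/n≡m; m<n⇒m/n≡0)
open import Data.Nat.Divisibility using (m∣m*n)
open import Data.Fin using (Fin; zero; suc; toℕ; combine; _↑ˡ_; _↑ʳ_; punchIn; fromℕ<)
open import Data.Fin.Properties as Fin using (toℕ-combine; toℕ<n; punchInᵢ≢i; toℕ-fromℕ<; toℕ-injective)
open import Data.List using (List; []; _∷_; map; concatMap; _++_; tabulate)
open import Data.List.Membership.Propositional using (_∈_; lose)
open import Data.List.Membership.Propositional.Properties using (∈-allFin; ∈-map⁺; ∈-concatMap⁺)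
open import Data.List.Relation.Unary.Any using (here; there)
open import Data.Bool using (Bool; true; false; _∧_; _∨_; not; if_then_else_)
open import Data.Bool.Properties using (∧-zeroʳ; ∧-identityʳ; not-injective; ¬-not)
open import Data.Maybe using (Maybe; just; nothing)
open import Data.Product using (_×_; _,_; proj₁; proj₂; ∃; ∃₂)
open import Data.Sum using (inj₁; inj₂)
open import Data.Rational using (ℚ; 0ℚ; 1ℚ; 1/_; ≢-nonZero; nonNegative; nonPositive)
  renaming (_+_ to _+ℚ_; _*_ to _*ℚ_; _≤_ to _≤ℚ_)
open import Data.Rational.Properties as ℚ
  using (+-identityˡ; +-identityʳ; +-assoc; +-comm; *-identityˡ; *-zeroˡ; *-zeroʳ; *-assoc; *-comm
        ; *-distribˡ-+; *-inverseˡ; ≤-antisym; ≤-trans; ≤-reflexive; +-mono-≤; +-monoʳ-≤; ≤-total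
        ; nonNegative⁻¹; nonNeg*nonNeg⇒nonNeg; nonPos*nonPos⇒nonPos)
open import Algebra.Bundles using (CommutativeRing)
open import Algebra.Properties.Semiring.Sum (CommutativeRing.semiring ℚ.+-*-commutativeRing)
  using (sum; sum-syntax; ∑-comm; sum-cong-≗; sum-replicate-zero; sum-remove; *-distribʳ-sum)
open import Relation.Nullary using (Dec; yes; no; does)
open import Relation.Nullary.Decidable using (dec-true; dec-false)
open import Relation.Binary.PropositionalEquality
open ≡-Reasoning

private variable
  A B : Set

Σ-cong : (xs : List A) {f g : A → ℚ} → (∀ x → f x ≡ g x) → Σ[ xs ] f ≡ Σ[ xs ] g
Σ-cong []       f≗g = refl
Σ-cong (x ∷ xs) f≗g = cong₂ _+ℚ_ (f≗g x) (Σ-cong xs f≗g)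

Σ-zero : (xs : List A) {f : A → ℚ} → (∀ x → f x ≡ 0ℚ) → Σ[ xs ] f ≡ 0ℚ
Σ-zero []       f≗0 = refl
Σ-zero (x ∷ xs) f≗0 = trans (cong₂ _+ℚ_ (f≗0 x) (Σ-zero xs f≗0)) (+-identityˡ 0ℚ)

Σ-+ : (xs : List A) (f g : A → ℚ) → Σ[ xs ] (λ x → f x +ℚ g x) ≡ Σ[ xs ] f +ℚ Σ[ xs ] g
Σ-+ []       f g = sym (+-identityˡ 0ℚ)
Σ-+ (x ∷ xs) f g = begin
  (f x +ℚ g x) +ℚ Σ[ xs ] (λ y → f y +ℚ g y) ≡⟨ cong ((f x +ℚ g x) +ℚ_) (Σ-+ xs f g) ⟩
  (f x +ℚ g x) +ℚ (Σ[ xs ] f +ℚ Σ[ xs ] g)   ≡⟨ +-assoc (f x) (g x) _ ⟩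
  f x +ℚ (g x +ℚ (Σ[ xs ] f +ℚ Σ[ xs ] g))   ≡⟨ cong (f x +ℚ_) (+-assoc (g x) _ _) ⟨
  f x +ℚ ((g x +ℚ Σ[ xs ] f) +ℚ Σ[ xs ] g)   ≡⟨ cong (λ u → f x +ℚ (u +ℚ Σ[ xs ] g)) (+-comm (g x) _) ⟩
  f x +ℚ ((Σ[ xs ] f +ℚ g x) +ℚ Σ[ xs ] g)   ≡⟨ cong (f x +ℚ_) (+-assoc (Σ[ xs ] f) (g x) _) ⟩
  f x +ℚ (Σ[ xs ] f +ℚ (g x +ℚ Σ[ xs ] g))   ≡⟨ +-assoc (f x) _ _ ⟨
  (f x +ℚ Σ[ xs ] f) +ℚ (g x +ℚ Σ[ xs ] g)   ∎

Σ-*ˡ : (xs : List A) (c : ℚ) (f : A → ℚ) → Σ[ xs ] (λ x → c *ℚ f x) ≡ c *ℚ Σ[ xs ] f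
Σ-*ˡ []       c f = sym (*-zeroʳ c)
Σ-*ˡ (x ∷ xs) c f = trans (cong (c *ℚ f x +ℚ_) (Σ-*ˡ xs c f)) (sym (*-distribˡ-+ c (f x) _))

Σ-*ʳ : (xs : List A) (c : ℚ) (f : A → ℚ) → Σ[ xs ] (λ x → f x *ℚ c) ≡ Σ[ xs ] f *ℚ c
Σ-*ʳ xs c f = trans (Σ-cong xs (λ x → *-comm (f x) c)) (trans (Σ-*ˡ xs c f) (*-comm c _))

Σ-comm : (xs : List A) (ys : List B) (f : A → B → ℚ) →
  Σ[ xs ] (λ x → Σ[ ys ] (f x)) ≡ Σ[ ys ] (λ y → Σ[ xs ] (λ x → f x y))
Σ-comm []       ys f = sym (Σ-zero ys (λ _ → refl))
Σ-comm (x ∷ xs) ys f = trans (cong (Σ[ ys ] (f x) +ℚ_) (Σ-comm xs ys f)) (sym (Σ-+ ys (f x) _))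

Σ-++ : (xs ys : List A) (f : A → ℚ) → Σ[ xs ++ ys ] f ≡ Σ[ xs ] f +ℚ Σ[ ys ] f
Σ-++ []       ys f = sym (+-identityˡ _)
Σ-++ (x ∷ xs) ys f = trans (cong (f x +ℚ_) (Σ-++ xs ys f)) (sym (+-assoc (f x) _ _))

Σ-concatMap : (g : A → List B) (xs : List A) (f : B → ℚ) →
  Σ[ concatMap g xs ] f ≡ Σ[ xs ] (λ x → Σ[ g x ] f)
Σ-concatMap g []       f = refl
Σ-concatMap g (x ∷ xs) f =
  trans (Σ-++ (g x) (concatMap g xs) f) (cong (Σ[ g x ] f +ℚ_) (Σ-concatMap g xs f))

Σ-map : (g : A → B) (xs : List A) (f : B → ℚ) → Σ[ map g xs ] f ≡ Σ[ xs ] (λ x → f (g x))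
Σ-map g []       f = refl
Σ-map g (x ∷ xs) f = cong (f (g x) +ℚ_) (Σ-map g xs f)

Σ-tabulate : (n : ℕ) (g : Fin n → A) (f : A → ℚ) → Σ[ tabulate g ] f ≡ ∑[ i < n ] f (g i)
Σ-tabulate zero    g f = refl
Σ-tabulate (suc n) g f = cong (f (g zero) +ℚ_) (Σ-tabulate n (λ i → g (suc i)) f)

Σ-allFin : (n : ℕ) (f : Fin n → ℚ) → Σ[ allFin n ] f ≡ ∑[ i < n ] f i
Σ-allFin n = Σ-tabulate n (λ i → i)

Σ-∑-comm : (xs : List A) (n : ℕ) (f : A → Fin n → ℚ) →
  Σ[ xs ] (λ x → ∑[ i < n ] f x i) ≡ ∑[ i < n ] Σ[ xs ] (λ x → f x i)
Σ-∑-comm xs n f = begin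
  Σ[ xs ] (λ x → ∑[ i < n ] f x i)            ≡⟨ Σ-cong xs (λ x → Σ-allFin n (f x)) ⟨
  Σ[ xs ] (λ x → Σ[ allFin n ] (f x))         ≡⟨ Σ-comm xs (allFin n) f ⟩
  Σ[ allFin n ] (λ i → Σ[ xs ] (λ x → f x i)) ≡⟨ Σ-allFin n _ ⟩
  ∑[ i < n ] Σ[ xs ] (λ x → f x i)            ∎

Σ-concatMap-allFin : ∀ {n} (g : Fin n → List B) (f : B → ℚ) →
  Σ[ concatMap g (allFin n) ] f ≡ ∑[ i < n ] Σ[ g i ] f
Σ-concatMap-allFin {n = n} g f = trans (Σ-concatMap g (allFin n) f) (Σ-allFin n (λ i → Σ[ g i ] f))

Σ-allTiles : ∀ n (f : Tile n → ℚ) → Σ[ allTiles n ] f ≡ ∑[ i < n ] ∑[ j < n ] ∑[ k < n ] f (i , j , k)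
Σ-allTiles n f =
  trans (Σ-concatMap-allFin (λ i → concatMap (λ j → map (λ k → (i , j , k)) (allFin n)) (allFin n)) f)
  (sum-cong-≗ {n} λ i → trans (Σ-concatMap-allFin (λ j → map (λ k → (i , j , k)) (allFin n)) f)
  (sum-cong-≗ {n} λ j → trans (Σ-map (λ k → (i , j , k)) (allFin n) f) (Σ-allFin n (λ k → f (i , j , k)))))

∑-zero : ∀ {n} (f : Fin n → ℚ) → (∀ i → f i ≡ 0ℚ) → ∑[ i < n ] f i ≡ 0ℚ
∑-zero {n} f f≗0 = trans (sum-cong-≗ f≗0) (sum-replicate-zero n)

∑-single : ∀ {n} (f : Fin n → ℚ) (i : Fin n) → (∀ j → j ≢ i → f j ≡ 0ℚ) → ∑[ j < n ] f j ≡ f i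
∑-single {suc n} f i off = begin
  sum f                              ≡⟨ sum-remove {i = i} f ⟩
  f i +ℚ ∑[ j < n ] f (punchIn i j)  ≡⟨ cong (f i +ℚ_) (∑-zero _ (λ j → off _ (punchInᵢ≢i i j))) ⟩
  f i +ℚ 0ℚ                          ≡⟨ +-identityʳ (f i) ⟩
  f i                                ∎

∑-↑ : ∀ m {n} (f : Fin (m + n) → ℚ) →
  ∑[ x < m + n ] f x ≡ ∑[ i < m ] f (i ↑ˡ n) +ℚ ∑[ j < n ] f (m ↑ʳ j)
∑-↑ zero    f = sym (+-identityˡ _)
∑-↑ (suc m) f = trans (cong (f zero +ℚ_) (∑-↑ m (λ x → f (suc x)))) (sym (+-assoc (f zero) _ _))

∑-combine : ∀ m n (f : Fin (m * n) → ℚ) → ∑[ x < m * n ] f x ≡ ∑[ i < m ] ∑[ j < n ] f (combine i j)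
∑-combine zero    n f = refl
∑-combine (suc m) n f =
  trans (∑-↑ n f) (cong (∑[ j < n ] f (j ↑ˡ m * n) +ℚ_) (∑-combine m n (λ x → f (n ↑ʳ x))))

𝟙 : Bool → ℚ
𝟙 b = if b then 1ℚ else 0ℚ

𝟙-off : ∀ {b} → b ≢ true → 𝟙 b ≡ 0ℚ
𝟙-off b≢true = cong 𝟙 (¬-not {y = true} b≢true)

∧-true : ∀ {x y} → x ∧ y ≡ true → x ≡ true × y ≡ true
∧-true {true} {true} _ = refl , refl

does-∧ : {P Q : Set} (p? : Dec P) (q? : Dec Q) → does p? ∧ does q? ≡ true → P × Q
does-∧ (yes p) (yes q) _ = p , q

=ᶠ-refl : ∀ {n} (a : Fin n) → (a =ᶠ a) ≡ true
=ᶠ-refl a = dec-true (a Fin.≟ a) refl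

∑-=ᶠ : ∀ {n} (a : Fin n) (F : Bool → Fin n → ℚ) → (∀ i → F false i ≡ 0ℚ) →
  ∑[ i < n ] F (a =ᶠ i) i ≡ F true a
∑-=ᶠ {n} a F F-false≡0 = begin
  ∑[ i < n ] F (a =ᶠ i) i  ≡⟨ ∑-single _ a elsewhere ⟩
  F (a =ᶠ a) a             ≡⟨ cong (λ x → F x a) (=ᶠ-refl a) ⟩
  F true a                 ∎
  where
  elsewhere : ∀ i → i ≢ a → F (a =ᶠ i) i ≡ 0ℚ
  elsewhere i i≢a =
    trans (cong (λ x → F x i) (dec-false (a Fin.≟ i) (λ a≡i → i≢a (sym a≡i)))) (F-false≡0 i)

∑-𝟙-=ⁿ : ∀ {n} m → m < n → ∑[ x < n ] 𝟙 (m =ⁿ toℕ x) ≡ 1ℚ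
∑-𝟙-=ⁿ {n} m m<n = begin
  ∑[ x < n ] 𝟙 (m =ⁿ toℕ x)  ≡⟨ ∑-single _ (fromℕ< m<n) elsewhere ⟩
  𝟙 (m =ⁿ toℕ (fromℕ< m<n))  ≡⟨ cong (λ k → 𝟙 (m =ⁿ k)) (toℕ-fromℕ< m<n) ⟩
  𝟙 (m =ⁿ m)                 ≡⟨ cong 𝟙 (dec-true (m ℕ.≟ m) refl) ⟩
  1ℚ                         ∎
  where
  elsewhere : ∀ x → x ≢ fromℕ< m<n → 𝟙 (m =ⁿ toℕ x) ≡ 0ℚ
  elsewhere x x≢m = cong 𝟙 (dec-false (m ℕ.≟ toℕ x)
    (λ m≡x → x≢m (toℕ-injective (trans (sym m≡x) (sym (toℕ-fromℕ< m<n))))))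

allB-∈ : ∀ {p : A → Bool} {xs} → allB p xs ≡ true → ∀ {x} → x ∈ xs → p x ≡ true
allB-∈ all (here refl)  = proj₁ (∧-true all)
allB-∈ all (there x∈xs) = allB-∈ (proj₂ (∧-true all)) x∈xs

allB-false : ∀ {p : A → Bool} xs → allB p xs ≡ false → ∃ λ x → p x ≡ false
allB-false {p = p} (x ∷ xs) all≡false with p x in px
... | false = x , px
... | true  = allB-false xs all≡false

∈-allTiles : ∀ {n} (t : Tile n) → t ∈ allTiles n
∈-allTiles (i , j , k) =
  ∈-concatMap⁺ _ (lose (∈-allFin i) (∈-concatMap⁺ _ (lose (∈-allFin j) (∈-map⁺ _ (∈-allFin k)))))

∈-allEdges : ∀ {n} (e : Edge n) → e ∈ allEdges n
∈-allEdges (rc a b) =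
  ∈-concatMap⁺ _ (lose (∈-allFin a) (∈-concatMap⁺ _ (lose (∈-allFin b) (here refl))))
∈-allEdges (rs a b) =
  ∈-concatMap⁺ _ (lose (∈-allFin a) (∈-concatMap⁺ _ (lose (∈-allFin b) (there (here refl)))))
∈-allEdges (cs a b) =
  ∈-concatMap⁺ _ (lose (∈-allFin a) (∈-concatMap⁺ _ (lose (∈-allFin b) (there (there (here refl))))))
∈-allEdges (bs a b) =
  ∈-concatMap⁺ _ (lose (∈-allFin a) (∈-concatMap⁺ _ (lose (∈-allFin b) (there (there (there (here refl)))))))

+-nonNeg-zeroˡ : ∀ {a b} → 0ℚ ≤ℚ a → 0ℚ ≤ℚ b → a +ℚ b ≡ 0ℚ → a ≡ 0ℚ
+-nonNeg-zeroˡ {a} {b} 0≤a 0≤b a+b≡0 = ≤-antisym a≤0 0≤a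
  where
  a≤0 : a ≤ℚ 0ℚ
  a≤0 = ≤-trans (≤-reflexive (sym (+-identityʳ a))) (≤-trans (+-monoʳ-≤ a 0≤b) (≤-reflexive a+b≡0))

Σ-nonNeg : (xs : List A) {f : A → ℚ} → (∀ x → 0ℚ ≤ℚ f x) → 0ℚ ≤ℚ Σ[ xs ] f
Σ-nonNeg []       f≥0 = ℚ.≤-refl
Σ-nonNeg (x ∷ xs) f≥0 =
  ≤-trans (≤-reflexive (sym (+-identityˡ 0ℚ))) (+-mono-≤ (f≥0 x) (Σ-nonNeg xs f≥0))

Σ-nonNeg-zero : {xs : List A} {f : A → ℚ} → (∀ x → 0ℚ ≤ℚ f x) → Σ[ xs ] f ≡ 0ℚ →
  ∀ {x} → x ∈ xs → f x ≡ 0ℚ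
Σ-nonNeg-zero {xs = y ∷ ys} f≥0 Σ≡0 (here refl) = +-nonNeg-zeroˡ (f≥0 y) (Σ-nonNeg ys f≥0) Σ≡0
Σ-nonNeg-zero {xs = y ∷ ys} {f} f≥0 Σ≡0 (there x∈ys) = Σ-nonNeg-zero f≥0 tail≡0 x∈ys
  where
  tail≡0 : Σ[ ys ] f ≡ 0ℚ
  tail≡0 = +-nonNeg-zeroˡ (Σ-nonNeg ys f≥0) (f≥0 y) (trans (+-comm (Σ[ ys ] f) (f y)) Σ≡0)

∑-1≢0 : ∀ n .{{_ : NonZero n}} → ∑[ _ < n ] 1ℚ ≢ 0ℚ
∑-1≢0 (suc m) sum≡0 = ℚ.1≢0 (+-nonNeg-zeroˡ (nonNegative⁻¹ 1ℚ) rest≥0 sum≡0)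
  where
  rest≥0 : 0ℚ ≤ℚ ∑[ _ < m ] 1ℚ
  rest≥0 = subst (0ℚ ≤ℚ_) (Σ-allFin m (λ _ → 1ℚ)) (Σ-nonNeg (allFin m) (λ _ → nonNegative⁻¹ 1ℚ))

*-cancelˡ-zero : ∀ c {x} → c ≢ 0ℚ → c *ℚ x ≡ 0ℚ → x ≡ 0ℚ
*-cancelˡ-zero c {x} c≢0 cx≡0 = begin
  x                  ≡⟨ *-identityˡ x ⟨
  1ℚ *ℚ x            ≡⟨ cong (_*ℚ x) (*-inverseˡ c) ⟨
  (1/ c *ℚ c) *ℚ x   ≡⟨ *-assoc (1/ c) c x ⟩
  1/ c *ℚ (c *ℚ x)   ≡⟨ cong (1/ c *ℚ_) cx≡0 ⟩
  1/ c *ℚ 0ℚ         ≡⟨ *-zeroʳ (1/ c) ⟩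
  0ℚ                 ∎
  where instance _ = ≢-nonZero c≢0

square-nonNeg : ∀ x → 0ℚ ≤ℚ x *ℚ x
square-nonNeg x with ≤-total 0ℚ x
... | inj₁ 0≤x = let instance _ = nonNegative 0≤x in nonNegative⁻¹ _ {{nonNeg*nonNeg⇒nonNeg x x}}
... | inj₂ x≤0 = let instance _ = nonPositive x≤0 in nonNegative⁻¹ _ {{nonPos*nonPos⇒nonPos x x}}

square-zero : ∀ {x} → x *ℚ x ≡ 0ℚ → x ≡ 0ℚ
square-zero {x} x²≡0 with x ℚ.≟ 0ℚ
... | yes x≡0 = x≡0
... | no  x≢0 = *-cancelˡ-zero x x≢0 x²≡0

module _ {E T : Set} (Es : List E) (Ts : List T) (V : E → T → ℚ) (z : E → ℚ) where

  Vᵀz : T → ℚ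
  Vᵀz t = Σ[ Es ] (λ e → V e t *ℚ z e)

  Σ-gram : Σ[ Es ] (λ e → z e *ℚ Σ[ Es ] (λ f → Σ[ Ts ] (λ t → V e t *ℚ V f t) *ℚ z f))
         ≡ Σ[ Ts ] (λ t → Vᵀz t *ℚ Vᵀz t)
  Σ-gram = begin
    Σ[ Es ] (λ e → z e *ℚ Σ[ Es ] (λ f → Σ[ Ts ] (λ t → V e t *ℚ V f t) *ℚ z f))
      ≡⟨ Σ-cong Es (λ e → cong (z e *ℚ_) (inner e)) ⟩
    Σ[ Es ] (λ e → z e *ℚ Σ[ Ts ] (λ t → V e t *ℚ Vᵀz t))
      ≡⟨ Σ-cong Es (λ e → Σ-*ˡ Ts (z e) (λ t → V e t *ℚ Vᵀz t)) ⟨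
    Σ[ Es ] (λ e → Σ[ Ts ] (λ t → z e *ℚ (V e t *ℚ Vᵀz t)))
      ≡⟨ Σ-comm Es Ts (λ e t → z e *ℚ (V e t *ℚ Vᵀz t)) ⟩
    Σ[ Ts ] (λ t → Σ[ Es ] (λ e → z e *ℚ (V e t *ℚ Vᵀz t)))
      ≡⟨ Σ-cong Ts (λ t → Σ-cong Es (λ e → reassociate (z e) (V e t) (Vᵀz t))) ⟩
    Σ[ Ts ] (λ t → Σ[ Es ] (λ e → (V e t *ℚ z e) *ℚ Vᵀz t))
      ≡⟨ Σ-cong Ts (λ t → Σ-*ʳ Es (Vᵀz t) (λ e → V e t *ℚ z e)) ⟩
    Σ[ Ts ] (λ t → Vᵀz t *ℚ Vᵀz t) ∎
    where
    reassociate : ∀ a b c → a *ℚ (b *ℚ c) ≡ (b *ℚ a) *ℚ c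
    reassociate a b c = trans (sym (*-assoc a b c)) (cong (_*ℚ c) (*-comm a b))
    inner : ∀ e →
      Σ[ Es ] (λ f → Σ[ Ts ] (λ t → V e t *ℚ V f t) *ℚ z f) ≡ Σ[ Ts ] (λ t → V e t *ℚ Vᵀz t)
    inner e = begin
      Σ[ Es ] (λ f → Σ[ Ts ] (λ t → V e t *ℚ V f t) *ℚ z f)
        ≡⟨ Σ-cong Es (λ f → Σ-*ʳ Ts (z f) (λ t → V e t *ℚ V f t)) ⟨
      Σ[ Es ] (λ f → Σ[ Ts ] (λ t → (V e t *ℚ V f t) *ℚ z f))
        ≡⟨ Σ-comm Es Ts (λ f t → (V e t *ℚ V f t) *ℚ z f) ⟩
      Σ[ Ts ] (λ t → Σ[ Es ] (λ f → (V e t *ℚ V f t) *ℚ z f))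
        ≡⟨ Σ-cong Ts (λ t → trans (Σ-cong Es (λ f → *-assoc (V e t) (V f t) (z f)))
                                  (Σ-*ˡ Es (V e t) (λ f → V f t *ℚ z f))) ⟩
      Σ[ Ts ] (λ t → V e t *ℚ Vᵀz t) ∎

  gram-kernel : (∀ e → Σ[ Es ] (λ f → Σ[ Ts ] (λ t → V e t *ℚ V f t) *ℚ z f) ≡ 0ℚ) →
    ∀ {t} → t ∈ Ts → Vᵀz t ≡ 0ℚ
  gram-kernel Gz≡0 t∈Ts = square-zero (Σ-nonNeg-zero (λ t → square-nonNeg (Vᵀz t)) zᵀGz≡0 t∈Ts)
    where
    zᵀGz≡0 : Σ[ Ts ] (λ t → Vᵀz t *ℚ Vᵀz t) ≡ 0ℚ
    zᵀGz≡0 = trans (sym Σ-gram) (Σ-zero Es (λ e → trans (cong (z e *ℚ_) (Gz≡0 e)) (*-zeroʳ (z e))))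

projKer-rows-in-ker : ∀ {n} {A P : EMat n} → IsOrthProjOntoKer A P →
  ∀ e₀ e → Σ[ allEdges n ] (λ f → A e f *ℚ P e₀ f) ≡ 0ℚ
projKer-rows-in-ker {n} {A} {P} (symm , idem , range⊆ker , _) e₀ e =
  trans (Σ-cong (allEdges n) (λ f → cong (A e f *ℚ_) (row≡column f))) (range⊆ker (λ g → P g e₀) e)
  where
  row≡column : ∀ f → P e₀ f ≡ Σ[ allEdges n ] (λ g → P f g *ℚ P g e₀)
  row≡column f = trans (symm e₀ f) (sym (idem f e₀))

[n*q+r]/n≡q : ∀ n q {r} .{{_ : NonZero n}} → r < n → (n * q + r) / n ≡ q
[n*q+r]/n≡q n q {r} r<n = begin
  (n * q + r) / n      ≡⟨ +-distrib-/-∣ˡ r (m∣m*n q) ⟩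
  n * q / n + r / n    ≡⟨ cong₂ _+_ (trans (cong (_/ n) (ℕ.*-comm n q)) (m*n/n≡m q n)) (m<n⇒m/n≡0 r<n) ⟩
  q + 0                ≡⟨ ℕ.+-identityʳ q ⟩
  q                    ∎

module _ (h w : ℕ) .{{_ : NonZero h}} .{{_ : NonZero w}} where

  private
    n = h * w
    Es = allEdges n
    Ts = allTiles n

  box-combine : ∀ q r {a b} → a < h → b < w → box h w (h * q + a) (w * r + b) ≡ h * q + r
  box-combine q r a<h b<w = cong₂ (λ x y → h * x + y) ([n*q+r]/n≡q h q a<h) ([n*q+r]/n≡q w r b<w)

  -- Writing i = h q + a and j = w r + b (q < w, a < h, r < h, b < w), cell (i , j) lies in box h q + r.
  ∑-box : ∀ l → l < n →
    ∑[ i < n ] ∑[ j < n ] 𝟙 (l =ⁿ box h w (toℕ i) (toℕ j)) ≡ ∑[ _ < n ] 1ℚ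
  ∑-box l l<n = begin
    ∑[ i < h * w ] F (toℕ i)
      ≡⟨ cong (λ N → ∑[ i < N ] F (toℕ i)) (ℕ.*-comm h w) ⟩
    ∑[ i < w * h ] F (toℕ i)
      ≡⟨ ∑-combine w h (λ i → F (toℕ i)) ⟩
    ∑[ q < w ] ∑[ a < h ] F (toℕ (combine q a))
      ≡⟨ sum-cong-≗ (λ q → sum-cong-≗ {h} (λ a → in-box q a)) ⟩
    ∑[ q < w ] ∑[ a < h ] ∑[ r < h ] ∑[ b < w ] δ q r
      ≡⟨ ∑-comm {w} {h} (λ q a → ∑[ r < h ] ∑[ b < w ] δ q r) ⟩
    ∑[ a < h ] ∑[ q < w ] ∑[ r < h ] ∑[ b < w ] δ q r
      ≡⟨ sum-cong-≗ {h} (λ a → sum-cong-≗ (λ q → ∑-comm {h} {w} (λ r b → δ q r))) ⟩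
    ∑[ a < h ] ∑[ q < w ] ∑[ b < w ] ∑[ r < h ] δ q r
      ≡⟨ sum-cong-≗ {h} (λ a → ∑-comm {w} {w} (λ q b → ∑[ r < h ] δ q r)) ⟩
    ∑[ a < h ] ∑[ b < w ] ∑[ q < w ] ∑[ r < h ] δ q r
      ≡⟨ sum-cong-≗ {h} (λ a → sum-cong-≗ {w} (λ b → one-box)) ⟩
    ∑[ a < h ] ∑[ b < w ] 1ℚ
      ≡⟨ ∑-combine h w (λ _ → 1ℚ) ⟨
    ∑[ _ < h * w ] 1ℚ ∎
    where
    F : ℕ → ℚ
    F i = ∑[ j < n ] 𝟙 (l =ⁿ box h w i (toℕ j))
    δ : Fin w → Fin h → ℚ
    δ q r = 𝟙 (l =ⁿ (h * toℕ q + toℕ r))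
    in-box : ∀ q a → F (toℕ (combine q a)) ≡ ∑[ r < h ] ∑[ b < w ] δ q r
    in-box q a = begin
      F (toℕ (combine q a))
        ≡⟨ cong F (toℕ-combine q a) ⟩
      F i
        ≡⟨ ∑-combine h w (λ j → 𝟙 (l =ⁿ box h w i (toℕ j))) ⟩
      ∑[ r < h ] ∑[ b < w ] 𝟙 (l =ⁿ box h w i (toℕ (combine r b)))
        ≡⟨ sum-cong-≗ {h} (λ r → sum-cong-≗ {w} (λ b →
             cong (λ j → 𝟙 (l =ⁿ box h w i j)) (toℕ-combine r b))) ⟩
      ∑[ r < h ] ∑[ b < w ] 𝟙 (l =ⁿ box h w i (w * toℕ r + toℕ b))
        ≡⟨ sum-cong-≗ {h} (λ r → sum-cong-≗ {w} (λ b →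
             cong (λ k → 𝟙 (l =ⁿ k)) (box-combine (toℕ q) (toℕ r) (toℕ<n a) (toℕ<n b)))) ⟩
      ∑[ r < h ] ∑[ b < w ] δ q r ∎
      where
      i = h * toℕ q + toℕ a
    one-box : ∑[ q < w ] ∑[ r < h ] δ q r ≡ 1ℚ
    one-box = begin
      ∑[ q < w ] ∑[ r < h ] δ q r
        ≡⟨ sum-cong-≗ {w} (λ q → sum-cong-≗ {h} (λ r →
             cong (λ k → 𝟙 (l =ⁿ k)) (toℕ-combine q r))) ⟨
      ∑[ q < w ] ∑[ r < h ] 𝟙 (l =ⁿ toℕ (combine q r))
        ≡⟨ ∑-combine w h (λ x → 𝟙 (l =ⁿ toℕ x)) ⟨
      ∑[ x < w * h ] 𝟙 (l =ⁿ toℕ x)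
        ≡⟨ ∑-𝟙-=ⁿ l (subst (l <_) (ℕ.*-comm h w) l<n) ⟩
      1ℚ ∎

  tiles-through : ∀ e → Σ[ Ts ] (W h w e) ≡ ∑[ _ < n ] 1ℚ
  tiles-through e = trans (Σ-allTiles n (W h w e)) (through e)
    where
    ∑∑-0ℚ : ∑[ _ < n ] ∑[ _ < n ] 0ℚ ≡ 0ℚ
    ∑∑-0ℚ = trans (sum-cong-≗ {n} (λ _ → sum-replicate-zero n)) (sum-replicate-zero n)
    through : ∀ e → ∑[ i < n ] ∑[ j < n ] ∑[ k < n ] W h w e (i , j , k) ≡ ∑[ _ < n ] 1ℚ
    through (rc a b) = begin
      ∑[ i < n ] ∑[ j < n ] ∑[ k < n ] 𝟙 ((a =ᶠ i) ∧ (b =ᶠ j))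
        ≡⟨ ∑-=ᶠ a (λ x i → ∑[ j < n ] ∑[ k < n ] 𝟙 (x ∧ (b =ᶠ j))) (λ _ → ∑∑-0ℚ) ⟩
      ∑[ j < n ] ∑[ k < n ] 𝟙 (b =ᶠ j)
        ≡⟨ ∑-=ᶠ b (λ x j → ∑[ k < n ] 𝟙 x) (λ _ → sum-replicate-zero n) ⟩
      ∑[ _ < n ] 1ℚ ∎
    through (rs a b) = begin
      ∑[ i < n ] ∑[ j < n ] ∑[ k < n ] 𝟙 ((a =ᶠ i) ∧ (b =ᶠ k))
        ≡⟨ ∑-=ᶠ a (λ x i → ∑[ j < n ] ∑[ k < n ] 𝟙 (x ∧ (b =ᶠ k))) (λ _ → ∑∑-0ℚ) ⟩
      ∑[ j < n ] ∑[ k < n ] 𝟙 (b =ᶠ k)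
        ≡⟨ sum-cong-≗ {n} (λ j → ∑-=ᶠ b (λ x k → 𝟙 x) (λ _ → refl)) ⟩
      ∑[ _ < n ] 1ℚ ∎
    through (cs a b) = begin
      ∑[ i < n ] ∑[ j < n ] ∑[ k < n ] 𝟙 ((a =ᶠ j) ∧ (b =ᶠ k))
        ≡⟨ sum-cong-≗ {n} (λ i → ∑-=ᶠ a (λ x j → ∑[ k < n ] 𝟙 (x ∧ (b =ᶠ k))) (λ _ → sum-replicate-zero n)) ⟩
      ∑[ i < n ] ∑[ k < n ] 𝟙 (b =ᶠ k)
        ≡⟨ sum-cong-≗ {n} (λ i → ∑-=ᶠ b (λ x k → 𝟙 x) (λ _ → refl)) ⟩
      ∑[ _ < n ] 1ℚ ∎
    through (bs l b) = begin
      ∑[ i < n ] ∑[ j < n ] ∑[ k < n ] 𝟙 (inBox i j ∧ (b =ᶠ k))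
        ≡⟨ sum-cong-≗ {n} (λ i → sum-cong-≗ {n} (λ j →
             ∑-=ᶠ b (λ x k → 𝟙 (inBox i j ∧ x)) (λ _ → cong 𝟙 (∧-zeroʳ (inBox i j))))) ⟩
      ∑[ i < n ] ∑[ j < n ] 𝟙 (inBox i j ∧ true)
        ≡⟨ sum-cong-≗ {n} (λ i → sum-cong-≗ {n} (λ j → cong 𝟙 (∧-identityʳ (inBox i j)))) ⟩
      ∑[ i < n ] ∑[ j < n ] 𝟙 (inBox i j)
        ≡⟨ ∑-box (toℕ l) (toℕ<n l) ⟩
      ∑[ _ < n ] 1ℚ ∎
      where
      inBox : Fin n → Fin n → Bool
      inBox i j = toℕ l =ⁿ box h w (toℕ i) (toℕ j)

  InKerWᵀ : (Edge n → ℚ) → Set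
  InKerWᵀ z = ∀ t → Σ[ Es ] (λ f → W h w f t *ℚ z f) ≡ 0ℚ

  ker-Wᵀ-sum-zero : ∀ z → InKerWᵀ z → Σ[ Es ] z ≡ 0ℚ
  ker-Wᵀ-sum-zero z Wᵀz≡0 = *-cancelˡ-zero (∑[ _ < n ] 1ℚ) (∑-1≢0 n {{ℕ.m*n≢0 h w}}) (begin
    ∑[ _ < n ] 1ℚ *ℚ Σ[ Es ] z                        ≡⟨ Σ-*ˡ Es (∑[ _ < n ] 1ℚ) z ⟨
    Σ[ Es ] (λ f → ∑[ _ < n ] 1ℚ *ℚ z f)              ≡⟨ Σ-cong Es (λ f → cong (_*ℚ z f) (tiles-through f)) ⟨
    Σ[ Es ] (λ f → Σ[ Ts ] (W h w f) *ℚ z f)          ≡⟨ Σ-cong Es (λ f → Σ-*ʳ Ts (z f) (W h w f)) ⟨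
    Σ[ Es ] (λ f → Σ[ Ts ] (λ t → W h w f t *ℚ z f))  ≡⟨ Σ-comm Es Ts (λ f t → W h w f t *ℚ z f) ⟩
    Σ[ Ts ] (λ t → Σ[ Es ] (λ f → W h w f t *ℚ z f))  ≡⟨ Σ-zero Ts Wᵀz≡0 ⟩
    0ℚ                                                 ∎)

  projKer-rows-in-ker-Wᵀ : ∀ {K} → IsOrthProjOntoKer (M h w) K → ∀ e → InKerWᵀ (K e)
  projKer-rows-in-ker-Wᵀ {K} K-proj e t =
    gram-kernel Es Ts (W h w) (K e) (projKer-rows-in-ker {A = M h w} K-proj e) (∈-allTiles t)

  covers : Edge n → Fin n → Fin n → Maybe (Fin n) → Bool
  covers e i j nothing  = false
  covers e i j (just k) = inTile h w (i , j , k) e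

  coverCount : Array n → Edge n → ℚ
  coverCount S e = ∑[ i < n ] ∑[ j < n ] 𝟙 (covers e i j (S i j))

  module _ (S : Array n) where

    inGS⇒uncovered : ∀ {e} → inGS h w S e ≡ true → ∀ i j → covers e i j (S i j) ≡ false
    inGS⇒uncovered e∈GS i j with S i j | allB-∈ (allB-∈ e∈GS (∈-allFin i)) (∈-allFin j)
    ... | nothing | _  = refl
    ... | just k  | ok = not-injective ok

    ∉GS⇒covered : ∀ {e} → inGS h w S e ≡ false → ∃₂ λ i j → covers e i j (S i j) ≡ true
    ∉GS⇒covered e∉GS with allB-false (allFin n) e∉GS
    ... | i , row with allB-false (allFin n) row
    ... | j , cell with S i j in Sij | cell
    ... | just k | bad = i , j , subst (λ m → covers _ i j m ≡ true) (sym Sij) (not-injective bad)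

    coverCount-inGS : ∀ {e} → inGS h w S e ≡ true → coverCount S e ≡ 0ℚ
    coverCount-inGS {e} e∈GS =
      ∑-zero (λ i → ∑[ j < n ] 𝟙 (covers e i j (S i j))) (λ i →
      ∑-zero (λ j → 𝟙 (covers e i j (S i j))) (λ j → cong 𝟙 (inGS⇒uncovered e∈GS i j)))

    ker-Wᵀ-coverCount : ∀ z → InKerWᵀ z → Σ[ Es ] (λ f → coverCount S f *ℚ z f) ≡ 0ℚ
    ker-Wᵀ-coverCount z Wᵀz≡0 = begin
      Σ[ Es ] (λ f → coverCount S f *ℚ z f)
        ≡⟨ Σ-cong Es (λ f → trans (*-distribʳ-sum (z f) (λ i → ∑[ j < n ] 𝟙 (covers f i j (S i j))))
             (sum-cong-≗ {n} (λ i → *-distribʳ-sum (z f) (λ j → 𝟙 (covers f i j (S i j)))))) ⟩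
      Σ[ Es ] (λ f → ∑[ i < n ] ∑[ j < n ] term f i j)
        ≡⟨ Σ-∑-comm Es n (λ f i → ∑[ j < n ] term f i j) ⟩
      ∑[ i < n ] Σ[ Es ] (λ f → ∑[ j < n ] term f i j)
        ≡⟨ sum-cong-≗ {n} (λ i → Σ-∑-comm Es n (λ f j → term f i j)) ⟩
      ∑[ i < n ] ∑[ j < n ] Σ[ Es ] (λ f → term f i j)
        ≡⟨ ∑-zero _ (λ i → ∑-zero (λ j → Σ[ Es ] (λ f → term f i j)) (cell i)) ⟩
      0ℚ ∎
      where
      term : Edge n → Fin n → Fin n → ℚ
      term f i j = 𝟙 (covers f i j (S i j)) *ℚ z f
      cell : ∀ i j → Σ[ Es ] (λ f → term f i j) ≡ 0ℚ
      cell i j with S i j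
      ... | nothing = Σ-zero Es (λ f → *-zeroˡ (z f))
      ... | just k  = Wᵀz≡0 (i , j , k)

    tiles-of-GS-avoid : ∀ {t g} → inTGS h w S t ≡ true → inGS h w S g ≡ false → inTile h w t g ≡ false
    tiles-of-GS-avoid {t} {g} t∈TGS g∉GS = avoid (allB-∈ t∈TGS (∈-allEdges g)) g∉GS
      where
      avoid : ∀ {x y} → not x ∨ y ≡ true → y ≡ false → x ≡ false
      avoid {false} _    _    = refl
      avoid {true}  refl ()

    restricted-MS-by-tiles : (z : Edge n → ℚ) (f g : Edge n) →
      (if inGS h w S g then z g *ℚ MS h w S g f else 0ℚ)
      ≡ Σ[ Ts ] (λ t → if inTGS h w S t then (W h w g t *ℚ z g) *ℚ W h w f t else 0ℚ)
    restricted-MS-by-tiles z f g with inGS h w S g in g∈GS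
    ... | true  = trans (sym (Σ-*ˡ Ts (z g) _)) (Σ-cong Ts pull)
      where
      pull : ∀ t → z g *ℚ (if inTGS h w S t then W h w g t *ℚ W h w f t else 0ℚ)
                 ≡ (if inTGS h w S t then (W h w g t *ℚ z g) *ℚ W h w f t else 0ℚ)
      pull t with inTGS h w S t
      ... | true  = trans (sym (*-assoc (z g) _ _)) (cong (_*ℚ W h w f t) (*-comm (z g) (W h w g t)))
      ... | false = *-zeroʳ (z g)
    ... | false = sym (Σ-zero Ts vanish)
      where
      vanish : ∀ t → (if inTGS h w S t then (W h w g t *ℚ z g) *ℚ W h w f t else 0ℚ) ≡ 0ℚ
      vanish t with inTGS h w S t in t∈TGS
      ... | false = refl
      ... | true  = begin
        (𝟙 (inTile h w t g) *ℚ z g) *ℚ W h w f t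
          ≡⟨ cong (λ b → (𝟙 b *ℚ z g) *ℚ W h w f t) (tiles-of-GS-avoid t∈TGS g∈GS) ⟩
        (0ℚ *ℚ z g) *ℚ W h w f t ≡⟨ cong (_*ℚ W h w f t) (*-zeroˡ (z g)) ⟩
        0ℚ *ℚ W h w f t          ≡⟨ *-zeroˡ (W h w f t) ⟩
        0ℚ                       ∎

    restrict-ker-Wᵀ-⊥-MS : ∀ z → InKerWᵀ z →
      ∀ f → Σ[ Es ] (λ g → if inGS h w S g then z g *ℚ MS h w S g f else 0ℚ) ≡ 0ℚ
    restrict-ker-Wᵀ-⊥-MS z Wᵀz≡0 f = begin
      Σ[ Es ] (λ g → if inGS h w S g then z g *ℚ MS h w S g f else 0ℚ)
        ≡⟨ Σ-cong Es (restricted-MS-by-tiles z f) ⟩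
      Σ[ Es ] (λ g → Σ[ Ts ] (λ t → term t g))
        ≡⟨ Σ-comm Es Ts (λ g t → term t g) ⟩
      Σ[ Ts ] (λ t → Σ[ Es ] (term t))
        ≡⟨ Σ-zero Ts per-tile ⟩
      0ℚ ∎
      where
      term : Tile n → Edge n → ℚ
      term t g = if inTGS h w S t then (W h w g t *ℚ z g) *ℚ W h w f t else 0ℚ
      per-tile : ∀ t → Σ[ Es ] (term t) ≡ 0ℚ
      per-tile t with inTGS h w S t
      ... | false = Σ-zero Es (λ _ → refl)
      ... | true  = begin
        Σ[ Es ] (λ g → (W h w g t *ℚ z g) *ℚ W h w f t) ≡⟨ Σ-*ʳ Es (W h w f t) (λ g → W h w g t *ℚ z g) ⟩
        Σ[ Es ] (λ g → W h w g t *ℚ z g) *ℚ W h w f t   ≡⟨ cong (_*ℚ W h w f t) (Wᵀz≡0 t) ⟩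
        0ℚ *ℚ W h w f t                                 ≡⟨ *-zeroˡ (W h w f t) ⟩
        0ℚ                                              ∎

    module _ (Sd : IsPartialSudoku h w S) where

      filled-tiles-disjoint : ∀ e {i j k i′ j′ k′} → S i j ≡ just k → S i′ j′ ≡ just k′ →
        inTile h w (i , j , k) e ≡ true → inTile h w (i′ , j′ , k′) e ≡ true → i ≡ i′ × j ≡ j′
      filled-tiles-disjoint (rc a b) {i} {j} {k} {i′} {j′} {k′} _ _ t t′
        with refl , refl ← does-∧ (a Fin.≟ i) (b Fin.≟ j) t
           | refl , refl ← does-∧ (a Fin.≟ i′) (b Fin.≟ j′) t′ = refl , refl
      filled-tiles-disjoint (rs a b) {i} {j} {k} {i′} {j′} {k′} Sij Si′j′ t t′
        with refl , refl ← does-∧ (a Fin.≟ i) (b Fin.≟ k) t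
           | refl , refl ← does-∧ (a Fin.≟ i′) (b Fin.≟ k′) t′ = Sd i j i′ j′ k Sij Si′j′ (inj₁ refl)
      filled-tiles-disjoint (cs a b) {i} {j} {k} {i′} {j′} {k′} Sij Si′j′ t t′
        with refl , refl ← does-∧ (a Fin.≟ j) (b Fin.≟ k) t
           | refl , refl ← does-∧ (a Fin.≟ j′) (b Fin.≟ k′) t′ = Sd i j i′ j′ k Sij Si′j′ (inj₂ (inj₁ refl))
      filled-tiles-disjoint (bs l b) {i} {j} {k} {i′} {j′} {k′} Sij Si′j′ t t′
        with l≡box , refl ← does-∧ (toℕ l ℕ.≟ box h w (toℕ i) (toℕ j)) (b Fin.≟ k) t
           | l≡box′ , refl ← does-∧ (toℕ l ℕ.≟ box h w (toℕ i′) (toℕ j′)) (b Fin.≟ k′) t′ =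
        Sd i j i′ j′ k Sij Si′j′ (inj₂ (inj₂ (trans (sym l≡box) l≡box′)))

      covering-cell-unique : ∀ {e i j i′ j′} →
        covers e i j (S i j) ≡ true → covers e i′ j′ (S i′ j′) ≡ true → i ≡ i′ × j ≡ j′
      covering-cell-unique {e} {i} {j} {i′} {j′} c c′ with S i j in Sij | S i′ j′ in Si′j′
      ... | just k | just k′ = filled-tiles-disjoint e Sij Si′j′ c c′

      coverCount-∉GS : ∀ {e} → inGS h w S e ≡ false → coverCount S e ≡ 1ℚ
      coverCount-∉GS {e} e∉GS with ∉GS⇒covered e∉GS
      ... | i₀ , j₀ , c₀ = begin
        coverCount S e                         ≡⟨ ∑-single _ i₀ other-row ⟩
        ∑[ j < n ] 𝟙 (covers e i₀ j (S i₀ j))  ≡⟨ ∑-single _ j₀ other-column ⟩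
        𝟙 (covers e i₀ j₀ (S i₀ j₀))           ≡⟨ cong 𝟙 c₀ ⟩
        1ℚ                                     ∎
        where
        other-row : ∀ i → i ≢ i₀ → ∑[ j < n ] 𝟙 (covers e i j (S i j)) ≡ 0ℚ
        other-row i i≢i₀ =
          ∑-zero _ (λ j → 𝟙-off (λ c → i≢i₀ (proj₁ (covering-cell-unique {i = i} {j} c c₀))))
        other-column : ∀ j → j ≢ j₀ → 𝟙 (covers e i₀ j (S i₀ j)) ≡ 0ℚ
        other-column j j≢j₀ = 𝟙-off (λ c → j≢j₀ (proj₂ (covering-cell-unique {i = i₀} {j} c c₀)))

      restrict-ker-Wᵀ-⊥-𝟏 : ∀ z → InKerWᵀ z → Σ[ Es ] (λ f → if inGS h w S f then z f else 0ℚ) ≡ 0ℚ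
      restrict-ker-Wᵀ-⊥-𝟏 z Wᵀz≡0 = begin
        Σ[ Es ] restricted                                          ≡⟨ +-identityʳ _ ⟨
        Σ[ Es ] restricted +ℚ 0ℚ
          ≡⟨ cong (Σ[ Es ] restricted +ℚ_) (ker-Wᵀ-coverCount z Wᵀz≡0) ⟨
        Σ[ Es ] restricted +ℚ Σ[ Es ] (λ f → coverCount S f *ℚ z f)
          ≡⟨ Σ-+ Es restricted (λ f → coverCount S f *ℚ z f) ⟨
        Σ[ Es ] (λ f → restricted f +ℚ coverCount S f *ℚ z f)       ≡⟨ Σ-cong Es split ⟩
        Σ[ Es ] z                                                   ≡⟨ ker-Wᵀ-sum-zero z Wᵀz≡0 ⟩
        0ℚ                                                          ∎
        where
        restricted : Edge n → ℚ
        restricted f = if inGS h w S f then z f else 0ℚ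
        split : ∀ f → restricted f +ℚ coverCount S f *ℚ z f ≡ z f
        split f with inGS h w S f in f∈GS
        ... | true  = begin
          z f +ℚ coverCount S f *ℚ z f ≡⟨ cong (λ c → z f +ℚ c *ℚ z f) (coverCount-inGS f∈GS) ⟩
          z f +ℚ 0ℚ *ℚ z f             ≡⟨ cong (z f +ℚ_) (*-zeroˡ (z f)) ⟩
          z f +ℚ 0ℚ                    ≡⟨ +-identityʳ (z f) ⟩
          z f                          ∎
        ... | false = begin
          0ℚ +ℚ coverCount S f *ℚ z f  ≡⟨ cong (λ c → 0ℚ +ℚ c *ℚ z f) (coverCount-∉GS f∈GS) ⟩
          0ℚ +ℚ 1ℚ *ℚ z f              ≡⟨ +-identityˡ _ ⟩
          1ℚ *ℚ z f                    ≡⟨ *-identityˡ (z f) ⟩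
          z f                          ∎

proposition2p4 : (h w : ℕ) → .{{_ : NonZero h}} → .{{_ : NonZero w}} → 2 ≤ h → 2 ≤ w →
    (S : Array (h * w)) → IsPartialSudoku h w S →
    (K : EMat (h * w)) → IsOrthProjOntoKer (M h w) K →
    (∀ e → inGS h w S e ≡ true →
       Σ[ allEdges (h * w) ] (λ f → if inGS h w S f then K e f else 0ℚ) ≡ 0ℚ)
    × (∀ e f → inGS h w S e ≡ true → inGS h w S f ≡ true →
       Σ[ allEdges (h * w) ] (λ g → if inGS h w S g then K e g *ℚ MS h w S g f else 0ℚ) ≡ 0ℚ)
proposition2p4 h w _ _ S Sd K K-proj =
  (λ e _ → restrict-ker-Wᵀ-⊥-𝟏 h w S Sd (K e) (projKer-rows-in-ker-Wᵀ h w K-proj e)) ,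
  (λ e f _ _ → restrict-ker-Wᵀ-⊥-MS h w S (K e) (projKer-rows-in-ker-Wᵀ h w K-proj e) f)
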